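{- For any preference order $\sigma\in\{\pm1\}^n$, there exists a seating order $w$ such that $\nu(w,\sigma)=0$, i.e., no diner is napkinless.
   Context: A circular table has $n$ seats labelled $1,\dots,n$ (indices mod $n$), seat $i+1$ being immediately to the right of seat $i$; between seats $i$ and $i+1$ lies napkin $N_i$, so the diner in seat $i$ has left napkin $N_{i-1}$ and right napkin $N_i$. Diners $1,\dots,n$ are seated one at a time in the order $1,2,\dots,n$. A preference order $\sigma\in\{\pm1\}^n$ records that Diner $j$ prefers the right napkin if $\sigma_j=+1$ and the left napkin if $\sigma_j=-1$. When seated, a diner takes their preferred napkin if unclaimed, otherwise the other adjacent napkin if unclaimed, otherwise no napkin (they are then napkinless). A seating order is a permutation $w=(w_1,\dots,w_n)$ of $\{1,\dots,n\}$ with $w_1=1$, where $w_i=j$ means Diner $j$ sits in Seat $i$. $\nu(w,\sigma)$ is the number of napkinless diners. -}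

module Defs where

open import Data.Nat using (ℕ; zero; suc)
open import Data.Nat.DivMod using (_mod_)
open import Data.Fin using (Fin; toℕ; _≟_)
open import Data.Fin.Permutation using (Permutation′; _⟨$⟩ˡ_)
open import Data.Bool using (Bool; true; false; if_then_else_; _∨_)
open import Data.Sign using (Sign; +; -)
open import Data.List using (List; []; _∷_; allFin)
open import Relation.Nullary using (does)

-- Seats, diners and napkins are all indexed by
-- Fin m, 0-based: Fin-index s stands for Seat s+1 / Diner s+1, and napkin
-- index k stands for napkin N_k (indices mod m, so N_0 = N_m).

leftNapkin : ∀ {n} → Fin (suc n) → Fin (suc n)
leftNapkin s = s

rightNapkin : ∀ {n} → Fin (suc n) → Fin (suc n)
rightNapkin {n} s = suc (toℕ s) mod suc n

preferred : ∀ {n} → Sign → Fin (suc n) → Fin (suc n)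
preferred + s = rightNapkin s
preferred - s = leftNapkin s

other : ∀ {n} → Sign → Fin (suc n) → Fin (suc n)
other + s = leftNapkin s
other - s = rightNapkin s

Claimed : ℕ → Set
Claimed m = Fin m → Bool

claim : ∀ {m} → Fin m → Claimed m → Claimed m
claim t c k = does (k ≟ t) ∨ c k

-- A seating order: w ⟨$⟩ʳ seat = diner sitting there (w_i = j).
SeatingOrder : ℕ → Set
SeatingOrder m = Permutation′ m

napkinlessFrom : ∀ {n} → SeatingOrder (suc n) → (Fin (suc n) → Sign) →
                 Claimed (suc n) → List (Fin (suc n)) → ℕ
napkinlessFrom w σ c [] = zero
napkinlessFrom w σ c (d ∷ ds) =
  let s = w ⟨$⟩ˡ d
      p = preferred (σ d) s
      q = other (σ d) s
  in if c p
     then (if c q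
           then suc (napkinlessFrom w σ c ds)
           else napkinlessFrom w σ (claim q c) ds)
     else napkinlessFrom w σ (claim p c) ds

ν : ∀ {n} → SeatingOrder (suc n) → (Fin (suc n) → Sign) → ℕ
ν {n} w σ = napkinlessFrom w σ (λ _ → false) (allFin (suc n))

{-# OPTIONS --safe #-}
module Submission where

-- Seat the diners in order going round the table in the direction of Diner 1's
-- preferred napkin, and call the napkin on that side of a seat the one "ahead".
-- Diner 1 takes the napkin ahead, and every later diner is forced to do the same
-- whatever their own preference: the napkin behind was just taken by the previous
-- diner, while the napkin ahead is still free because distinct seats have
-- distinct napkins ahead.

open import Defs
open import Data.Nat using (ℕ; suc)
open import Data.Fin using (Fin; zero)
open import Data.Fin.Permutation using (_⟨$⟩ʳ_)
open import Data.Sign using (Sign)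
open import Data.Product using (∃-syntax; _×_)
open import Relation.Binary.PropositionalEquality using (_≡_)

open import Data.Bool using (true; false)
open import Data.Sign using (+; -)
open import Data.Nat using (s≤s)
open import Data.Nat.DivMod using (_%_; m<n⇒m%n≡m; n%n≡0)
open import Data.Fin as Fin using (toℕ; fromℕ; inject₁; opposite; _≟_)
open import Data.Fin.Properties
  using (toℕ-injective; toℕ-fromℕ<; toℕ-fromℕ; toℕ-inject₁; toℕ<n; suc-injective)
open import Data.Fin.Relation.Unary.Top using (view; ‵fromℕ; ‵inj₁)
open import Data.Fin.Permutation using (Permutation; _⟨$⟩ˡ_; id; flip; lift₀; reverse)
open import Data.List using ([]; _∷_; tabulate)
open import Data.List.Relation.Unary.All as All using (All; []; _∷_)
open import Data.List.Relation.Unary.Linked using (Linked; [-]; _∷_)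
open import Data.List.Relation.Unary.Unique.Propositional using (Unique; _∷_)
open import Data.List.Relation.Unary.Unique.Propositional.Properties using (allFin⁺)
open import Data.Product using (_,_)
open import Data.Sum using (_⊎_; inj₁; inj₂)
open import Function using (_∘_; Injective; Injection)
open import Function.Properties.Inverse using (↔⇒↣)
open import Relation.Binary.Core using (Rel)
open import Relation.Binary.PropositionalEquality
  using (_≢_; refl; sym; trans; cong; subst; module ≡-Reasoning)
open import Relation.Nullary.Decidable using (dec-true; dec-false)

tabulate⁺ : ∀ {a ℓ} {A : Set a} {R : Rel A ℓ} {n} (f : Fin (suc n) → A) →
  (∀ i → R (f (inject₁ i)) (f (Fin.suc i))) → Linked R (tabulate f)
tabulate⁺ {n = ℕ.zero} f _ = [-]
tabulate⁺ {n = suc n} f R-adjacent =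
  R-adjacent zero ∷ tabulate⁺ (f ∘ Fin.suc) (R-adjacent ∘ Fin.suc)

⟨$⟩ˡ-injective : ∀ {m n} (π : Permutation m n) → Injective _≡_ _≡_ (π ⟨$⟩ˡ_)
⟨$⟩ˡ-injective π = Injection.injective (↔⇒↣ (flip π))

opposite-inject₁ : ∀ {n} (i : Fin n) → opposite (inject₁ i) ≡ Fin.suc (opposite i)
opposite-inject₁ {suc n} zero = refl
opposite-inject₁ (Fin.suc i) = cong inject₁ (opposite-inject₁ i)

rightNapkin-inject₁ : ∀ {n} (i : Fin n) → rightNapkin (inject₁ i) ≡ Fin.suc i
rightNapkin-inject₁ {n} i = toℕ-injective (begin
  toℕ (rightNapkin (inject₁ i))  ≡⟨ toℕ-fromℕ< _ ⟩
  suc (toℕ (inject₁ i)) % suc n  ≡⟨ cong (λ k → suc k % suc n) (toℕ-inject₁ i) ⟩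
  suc (toℕ i) % suc n            ≡⟨ m<n⇒m%n≡m (s≤s (toℕ<n i)) ⟩
  suc (toℕ i)                    ∎)
  where open ≡-Reasoning

rightNapkin-fromℕ : ∀ n → rightNapkin (fromℕ n) ≡ zero
rightNapkin-fromℕ n = toℕ-injective (begin
  toℕ (rightNapkin (fromℕ n))  ≡⟨ toℕ-fromℕ< _ ⟩
  suc (toℕ (fromℕ n)) % suc n  ≡⟨ cong (λ k → suc k % suc n) (toℕ-fromℕ n) ⟩
  suc n % suc n                ≡⟨ n%n≡0 (suc n) ⟩
  0                            ∎)
  where open ≡-Reasoning

rightNapkin-injective : ∀ {n} → Injective _≡_ _≡_ (rightNapkin {n})
rightNapkin-injective {n} {s} {s′} with view s | view s′
... | ‵fromℕ | ‵fromℕ = λ _ → refl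
... | ‵fromℕ | ‵inj₁ {i = i} _ rewrite rightNapkin-fromℕ n | rightNapkin-inject₁ i = λ ()
... | ‵inj₁ {i = i} _ | ‵fromℕ rewrite rightNapkin-fromℕ n | rightNapkin-inject₁ i = λ ()
... | ‵inj₁ {i = i} _ | ‵inj₁ {i = i′} _ rewrite rightNapkin-inject₁ i | rightNapkin-inject₁ i′ =
  cong inject₁ ∘ suc-injective

preferred-injective : ∀ {n} sg → Injective _≡_ _≡_ (preferred {n} sg)
preferred-injective + = rightNapkin-injective
preferred-injective - = λ eq → eq

-- Diner j sits in seat −j (0-based, modulo the number of seats): the seats are
-- filled going left.
reflection : ∀ {n} → SeatingOrder (suc n)
reflection = lift₀ reverse

rightNapkin-reflection-suc : ∀ {n} (i : Fin n) →
  rightNapkin (reflection ⟨$⟩ˡ Fin.suc i) ≡ reflection ⟨$⟩ˡ inject₁ i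
rightNapkin-reflection-suc {suc n} zero = rightNapkin-fromℕ (suc n)
rightNapkin-reflection-suc (Fin.suc i) = begin
  rightNapkin (inject₁ (Fin.suc (opposite i)))  ≡⟨ rightNapkin-inject₁ (Fin.suc (opposite i)) ⟩
  Fin.suc (Fin.suc (opposite i))                ≡⟨ cong Fin.suc (opposite-inject₁ i) ⟨
  Fin.suc (opposite (inject₁ i))                ∎
  where open ≡-Reasoning

claim-self : ∀ {m} (t : Fin m) (c : Claimed m) → claim t c t ≡ true
claim-self t c rewrite dec-true (t ≟ t) refl = refl

claim-other : ∀ {m} {t u : Fin m} (c : Claimed m) → t ≢ u → claim u c t ≡ c t
claim-other {t = t} {u} c t≢u rewrite dec-false (t ≟ u) t≢u = refl

Takes : ∀ {n} → Claimed (suc n) → Sign → Fin (suc n) → Fin (suc n) → Set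
Takes c τ s t = preferred τ s ≡ t ⊎ (c (preferred τ s) ≡ true × other τ s ≡ t)

napkinlessFrom-takes : ∀ {n} (w : SeatingOrder (suc n)) σ c d ds {t} →
  c t ≡ false → Takes c (σ d) (w ⟨$⟩ˡ d) t →
  napkinlessFrom w σ c (d ∷ ds) ≡ napkinlessFrom w σ (claim t c) ds
napkinlessFrom-takes w σ c d ds free (inj₁ refl) rewrite free = refl
napkinlessFrom-takes w σ c d ds free (inj₂ (taken , refl)) rewrite taken | free = refl

takes-preferred : ∀ {n} (c : Claimed (suc n)) τ sg s →
  τ ≡ sg ⊎ c (other sg s) ≡ true → Takes c τ s (preferred sg s)
takes-preferred c τ sg s (inj₁ refl) = inj₁ refl
takes-preferred c + + s (inj₂ _) = inj₁ refl
takes-preferred c - - s (inj₂ _) = inj₁ refl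
takes-preferred c + - s (inj₂ taken) = inj₂ (taken , refl)
takes-preferred c - + s (inj₂ taken) = inj₂ (taken , refl)

module Sweep {n} (sg : Sign) (w : SeatingOrder (suc n)) (σ : Fin (suc n) → Sign) where

  ahead behind : Fin (suc n) → Fin (suc n)
  ahead d = preferred sg (w ⟨$⟩ˡ d)
  behind d = other sg (w ⟨$⟩ˡ d)

  ahead-injective : Injective _≡_ _≡_ ahead
  ahead-injective = ⟨$⟩ˡ-injective w ∘ preferred-injective sg

  takes-ahead : ∀ c d ds → c (ahead d) ≡ false → σ d ≡ sg ⊎ c (behind d) ≡ true →
    napkinlessFrom w σ c (d ∷ ds) ≡ napkinlessFrom w σ (claim (ahead d) c) ds
  takes-ahead c d ds free willing =
    napkinlessFrom-takes w σ c d ds free (takes-preferred c (σ d) sg (w ⟨$⟩ˡ d) willing)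

  sweep : ∀ c d ds → Unique (d ∷ ds) → Linked (λ d d′ → ahead d ≡ behind d′) (d ∷ ds) →
    All (λ d′ → c (ahead d′) ≡ false) (d ∷ ds) → σ d ≡ sg ⊎ c (behind d) ≡ true →
    napkinlessFrom w σ c (d ∷ ds) ≡ 0
  sweep c d [] _ _ (free ∷ []) willing = takes-ahead c d [] free willing
  sweep c d (d′ ∷ ds) (d∉ ∷ unique) (ahead≡behind ∷ linked) (free ∷ frees) willing = begin
    napkinlessFrom w σ c (d ∷ d′ ∷ ds)                ≡⟨ takes-ahead c d (d′ ∷ ds) free willing ⟩
    napkinlessFrom w σ c′ (d′ ∷ ds)                   ≡⟨ sweep c′ d′ ds unique linked frees′ (inj₂ taken) ⟩
    0                                                ∎
    where
    open ≡-Reasoning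
    c′ : Claimed (suc n)
    c′ = claim (ahead d) c
    frees′ : All (λ e → c′ (ahead e) ≡ false) (d′ ∷ ds)
    frees′ = All.zipWith (λ (d≢e , free) → trans (claim-other c (d≢e ∘ sym ∘ ahead-injective)) free)
                         (d∉ , frees)
    taken : c′ (behind d′) ≡ true
    taken = subst (λ t → c′ t ≡ true) ahead≡behind (claim-self (ahead d) c)

lemma3p1 : (n : ℕ) (σ : Fin (suc n) → Sign) →
    ∃[ w ] ((w ⟨$⟩ʳ zero ≡ zero) × (ν {n} w σ ≡ 0))
lemma3p1 n σ = by-first-preference (σ zero) refl
  where
  by-first-preference : ∀ sg → σ zero ≡ sg → ∃[ w ] ((w ⟨$⟩ʳ zero ≡ zero) × (ν {n} w σ ≡ 0))
  by-first-preference + first = id , refl ,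
    Sweep.sweep + id σ _ zero _ (allFin⁺ (suc n))
      (tabulate⁺ (λ d → d) rightNapkin-inject₁)
      (All.universal (λ _ → refl) _) (inj₁ first)
  by-first-preference - first = reflection , refl ,
    Sweep.sweep - reflection σ _ zero _ (allFin⁺ (suc n))
      (tabulate⁺ (λ d → d) (sym ∘ rightNapkin-reflection-suc))
      (All.universal (λ _ → refl) _) (inj₁ first)
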